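{- Let $S$ be a saw with backbone $(v_1,\dots,v_{2k+1},v_1)$ and degree $d(S)\geq 2(2k+1)/3$. Then \[ [2,2k+1]\subset R_S(v_{2k},v_{2k+1}). \]
   Context: A graph $S$ with vertex set $\{v_1,\dots,v_{2k+1}\}$ ($k\geq1$) is a saw if it contains the Hamiltonian cycle $(v_1,\dots,v_{2k+1},v_1)$ (its backbone) together with the chords $(v_{2s-1},v_{2s+1})$ for every $s\in\{1,\dots,k\}$; other edges may also be present. Its degree is $d(S)=\min\{d_S(v_{2k}),d_S(v_{2k+1})\}$, degrees taken in $S$. For distinct vertices $u,v$ of a graph $G$, $R_G(u,v)$ is the set of orders (numbers of vertices) of all paths in $G$ joining $u$ to $v$. $[m,n]=\{m,\dots,n\}$. -}

module Defs where

open import Data.Bool using (Bool; true; false)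
open import Data.Nat using (ℕ; zero; suc; _+_; _*_; _∸_; _≤_; _<_)
open import Data.Nat.DivMod using (_mod_)
open import Data.Fin using (Fin)
open import Data.List using (List; length; head; last; filterᵇ; allFin)
open import Data.List.Relation.Unary.Linked using (Linked)
open import Data.List.Relation.Unary.Unique.Propositional using (Unique)
open import Data.Maybe using (just)
open import Data.Product using (Σ; _×_)
open import Relation.Binary.PropositionalEquality using (_≡_)

record Graph (n : ℕ) : Set where
  field
    adj    : Fin n → Fin n → Bool
    sym    : ∀ i j → adj i j ≡ adj j i
    irrefl : ∀ i → adj i i ≡ false
open Graph public

deg : ∀ {n} → Graph n → Fin n → ℕ
deg {n} G i = length (filterᵇ (adj G i) (allFin n))

IsPath : ∀ {n} → Graph n → List (Fin n) → Set
IsPath G ps = Linked (λ a b → adj G a b ≡ true) ps × Unique ps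

-- the set R_G(u,v) of orders of paths joining u to v, as a predicate on ℕ
R : ∀ {n} → Graph n → Fin n → Fin n → ℕ → Set
R G u v m = Σ (List _) λ ps →
  IsPath G ps × head ps ≡ just u × last ps ≡ just v × length ps ≡ m

-- Vertex numbering for a saw on 2k+1 vertices: v_{j} (1-based) is  vtx k (j ∸ 1),
-- i.e. vtx k i is the 0-based index i (taken mod 2k+1).
vtx : (k : ℕ) → ℕ → Fin (suc (2 * k))
vtx k i = i mod (suc (2 * k))

-- G (on vertex set {v_1,…,v_{2k+1}}) is a saw with backbone (v_1,…,v_{2k+1},v_1)
-- and chords (v_{2s-1}, v_{2s+1}) for s ∈ {1,…,k}.  Other edges may be present.
record IsSaw (k : ℕ) (G : Graph (suc (2 * k))) : Set where
  field
    k≥1      : 1 ≤ k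
    backbone : ∀ i → i < suc (2 * k) → adj G (vtx k i) (vtx k (suc i)) ≡ true
    chords   : ∀ t → t < k → adj G (vtx k (2 * t)) (vtx k (2 * t + 2)) ≡ true

-- d(S) = min{ d(v_{2k}), d(v_{2k+1}) }
sawDeg : (k : ℕ) → Graph (suc (2 * k)) → ℕ
sawDeg k G = Data.Nat._⊓_ (deg G (vtx k (2 * k ∸ 1))) (deg G (vtx k (2 * k)))

-- The paths run from v_{2k} to v_{2k+1} = v_0 through strictly decreasing indices, so they never
-- repeat a vertex.  The orders k+2, …, 2k+1 come from v_{2k}, v_{2k-1}, then chords down to
-- some v_{2t+1}, then the backbone down to v_1 and v_0.  For an order j+3 ≤ k+2 put c = k-1-j.
-- If v_0 has a neighbour v_y with 2c+1 ≤ y ≤ 2c+j+1, the same kind of path, descending the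
-- backbone only to v_y and then jumping to v_0, has order j+3.  Otherwise, if some y ≤ 2c+j+1 has
-- v_y ~ v_0 and v_{y+j} ~ v_{2k}, take v_{2k}, v_{y+j}, v_{y+j-1}, …, v_y, v_0.  If neither
-- happens, counting the neighbours of v_0 and v_{2k} among v_1, …, v_{2k-1} gives
-- d(v_{2k}) + 2 d(v_{2k+1}) ≤ 4k < 3 d(S).
module Submission where

open import Defs
open import Data.Bool using (Bool; true; false)
open import Data.Empty using (⊥; ⊥-elim)
open import Data.Fin as Fin using (Fin; toℕ)
open import Data.Fin.Properties using (toℕ-injective; toℕ-fromℕ<; toℕ<n)
open import Data.List using (List; []; _∷_; length; head; last; filterᵇ; tabulate)
open import Data.List.Relation.Unary.All using (All; []; _∷_)
open import Data.List.Relation.Unary.AllPairs using ([]; _∷_)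
open import Data.List.Relation.Unary.Linked using (Linked; [-]; _∷_)
open import Data.List.Relation.Unary.Unique.Propositional using (Unique)
open import Data.Maybe using (just)
open import Data.Nat
open import Data.Nat.DivMod using (m<n⇒m%n≡m; n%n≡0)
open import Data.Nat.Properties
open import Data.Nat.Solver using (module +-*-Solver)
open import Data.Product using (∃-syntax; _×_; _,_)
open import Data.Sum using (_⊎_; inj₁; inj₂)
open import Function using (_∘_)
open import Relation.Binary.PropositionalEquality as ≡ hiding (sym)

open +-*-Solver

indicator : Bool → ℕ
indicator true  = 1
indicator false = 0

count : (ℕ → Bool) → ℕ → ℕ
count p zero    = 0
count p (suc n) = indicator (p 0) + count (p ∘ suc) n

indicator≤1 : ∀ b → indicator b ≤ 1
indicator≤1 true  = ≤-refl
indicator≤1 false = z≤n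

count≤ : ∀ p n → count p n ≤ n
count≤ p zero    = z≤n
count≤ p (suc n) = +-mono-≤ (indicator≤1 (p 0)) (count≤ (p ∘ suc) n)

count-+ : ∀ p m n → count p (m + n) ≡ count p m + count (λ i → p (m + i)) n
count-+ p zero    n = refl
count-+ p (suc m) n =
  trans (cong (indicator (p 0) +_) (count-+ (p ∘ suc) m n)) (≡.sym (+-assoc (indicator (p 0)) _ _))

count-suc : ∀ p n → count p (suc n) ≡ count p n + indicator (p n)
count-suc p zero    = +-identityʳ (indicator (p 0))
count-suc p (suc n) =
  trans (cong (indicator (p 0) +_) (count-suc (p ∘ suc) n)) (≡.sym (+-assoc (indicator (p 0)) _ _))

count-window : ∀ p a m b → count p (a + (m + b)) ≤ a + (count (λ i → p (a + i)) m + b)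
count-window p a m b = begin
  count p (a + (m + b))                          ≡⟨ count-+ p a (m + b) ⟩
  count p a + count q (m + b)                    ≡⟨ cong (count p a +_) (count-+ q m b) ⟩
  count p a + (count q m + count (λ i → q (m + i)) b)
    ≤⟨ +-mono-≤ (count≤ p a) (+-monoʳ-≤ (count q m) (count≤ _ b)) ⟩
  a + (count q m + b)                            ∎
  where
  open ≤-Reasoning
  q : ℕ → Bool
  q i = p (a + i)

count≡0⊎witness : ∀ p n → count p n ≡ 0 ⊎ ∃[ i ] i < n × p i ≡ true
count≡0⊎witness p zero = inj₁ refl
count≡0⊎witness p (suc n) with p 0 in p0 | count≡0⊎witness (p ∘ suc) n
... | true  | _                    = inj₂ (0 , z<s , p0)
... | false | inj₁ none            = inj₁ none
... | false | inj₂ (i , i<n , pi) = inj₂ (suc i , s<s i<n , pi)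

count-disjoint⊎common : ∀ p q n →
  count p n + count q n ≤ n ⊎ ∃[ i ] i < n × p i ≡ true × q i ≡ true
count-disjoint⊎common p q zero = inj₁ z≤n
count-disjoint⊎common p q (suc n) with count-disjoint⊎common (p ∘ suc) (q ∘ suc) n
... | inj₂ (i , i<n , pi , qi) = inj₂ (suc i , s<s i<n , pi , qi)
... | inj₁ bound with p 0 in p0 | q 0 in q0
...   | true  | true  = inj₂ (0 , z<s , p0 , q0)
...   | true  | false = inj₁ (s≤s bound)
...   | false | true  = inj₁ (≤-trans (≤-reflexive (+-suc _ _)) (s≤s bound))
...   | false | false = inj₁ (m≤n⇒m≤1+n bound)

indicator+indicator≤1 : ∀ {a b} → a ≡ false ⊎ b ≡ false → indicator a + indicator b ≤ 1
indicator+indicator≤1 {b = b} (inj₁ refl) = indicator≤1 b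
indicator+indicator≤1 {a = a} (inj₂ refl) = ≤-trans (≤-reflexive (+-identityʳ _)) (indicator≤1 a)

count-ends≤ : ∀ q L → q 0 ≡ false ⊎ q (suc L) ≡ false → count q (2 + L) ≤ suc (count (q ∘ suc) L)
count-ends≤ q L one-end-false = begin
  indicator a + count (q ∘ suc) (suc L)       ≡⟨ cong (indicator a +_) (count-suc (q ∘ suc) L) ⟩
  indicator a + (count (q ∘ suc) L + indicator b)
    ≡⟨ trans (cong (indicator a +_) (+-comm _ (indicator b))) (≡.sym (+-assoc (indicator a) _ _)) ⟩
  indicator a + indicator b + count (q ∘ suc) L ≤⟨ +-monoˡ-≤ _ (indicator+indicator≤1 one-end-false) ⟩
  suc (count (q ∘ suc) L)                     ∎
  where
  open ≤-Reasoning
  a b : Bool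
  a = q 0
  b = q (suc L)

length-filterᵇ-tabulate : ∀ {A : Set} {n} (q : A → Bool) (h : Fin n → A) (p : ℕ → Bool) →
  (∀ i → q (h i) ≡ p (toℕ i)) → length (filterᵇ q (tabulate h)) ≡ count p n
length-filterᵇ-tabulate {n = zero}  q h p agree = refl
length-filterᵇ-tabulate {n = suc n} q h p agree
  with q (h Fin.zero) | p 0 | agree Fin.zero
... | true  | .true  | refl = cong suc (length-filterᵇ-tabulate q (h ∘ Fin.suc) (p ∘ suc) (agree ∘ Fin.suc))
... | false | .false | refl = length-filterᵇ-tabulate q (h ∘ Fin.suc) (p ∘ suc) (agree ∘ Fin.suc)

toℕ-vtx : ∀ k {i} → i < suc (2 * k) → toℕ (vtx k i) ≡ i
toℕ-vtx k i<n = trans (toℕ-fromℕ< _) (m<n⇒m%n≡m i<n)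

vtx-toℕ : ∀ {k} (i : Fin (suc (2 * k))) → vtx k (toℕ i) ≡ i
vtx-toℕ {k} i = toℕ-injective (toℕ-vtx k (toℕ<n i))

deg≡count : ∀ {k} (G : Graph (suc (2 * k))) u → deg G u ≡ count (λ i → adj G u (vtx k i)) (suc (2 * k))
deg≡count {k} G u =
  length-filterᵇ-tabulate (adj G u) (λ i → i) (λ i → adj G u (vtx k i))
    (λ i → cong (adj G u) (≡.sym (vtx-toℕ {k} i)))

module Descents {n} (G : Graph n) (v : ℕ → Fin n) where

  Edge : ℕ → ℕ → Set
  Edge a b = adj G (v a) (v b) ≡ true

  data Descent : ℕ → ℕ → ℕ → Set where
    done : ∀ {a} → Descent a a 0
    step : ∀ {a b c ℓ} → b < a → Edge a b → Descent b c ℓ → Descent a c (suc ℓ)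

  infixr 5 _++_

  _++_ : ∀ {a b c ℓ ℓ′} → Descent a b ℓ → Descent b c ℓ′ → Descent a c (ℓ + ℓ′)
  done         ++ d′ = d′
  step b<a e d ++ d′ = step b<a e (d ++ d′)

  vertices : ∀ {a c ℓ} → Descent a c ℓ → List (Fin n)
  vertices {a} done         = v a ∷ []
  vertices {a} (step _ _ d) = v a ∷ vertices d

  vertices-linked : ∀ {a c ℓ} (d : Descent a c ℓ) → Linked (λ x y → adj G x y ≡ true) (vertices d)
  vertices-linked done                        = [-]
  vertices-linked (step _ e done)             = e ∷ [-]
  vertices-linked (step _ e d@(step _ _ _)) = e ∷ vertices-linked d

  head-vertices : ∀ {a c ℓ} (d : Descent a c ℓ) → head (vertices d) ≡ just (v a)
  head-vertices done         = refl
  head-vertices (step _ _ _) = refl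

  last-vertices : ∀ {a c ℓ} (d : Descent a c ℓ) → last (vertices d) ≡ just (v c)
  last-vertices done                        = refl
  last-vertices (step _ _ done)             = refl
  last-vertices (step _ _ d@(step _ _ _)) = last-vertices d

  length-vertices : ∀ {a c ℓ} (d : Descent a c ℓ) → length (vertices d) ≡ suc ℓ
  length-vertices done         = refl
  length-vertices (step _ _ d) = cong suc (length-vertices d)

  module _ (v-injective : ∀ {a b} → a < n → b < n → v a ≡ v b → a ≡ b) where

    v-distinct : ∀ {a b} → b < a → a < n → v a ≢ v b
    v-distinct b<a a<n eq = <-irrefl (≡.sym (v-injective a<n (<-trans b<a a<n) eq)) b<a

    vertices-avoid : ∀ {a b c ℓ} → b < a → a < n → (d : Descent b c ℓ) → All (v a ≢_) (vertices d)
    vertices-avoid b<a a<n done           = v-distinct b<a a<n ∷ []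
    vertices-avoid b<a a<n (step c<b _ d) = v-distinct b<a a<n ∷ vertices-avoid (<-trans c<b b<a) a<n d

    vertices-unique : ∀ {a c ℓ} → a < n → (d : Descent a c ℓ) → Unique (vertices d)
    vertices-unique a<n done             = [] ∷ []
    vertices-unique a<n (step b<a _ d) = vertices-avoid b<a a<n d ∷ vertices-unique (<-trans b<a a<n) d

    descent⇒R : ∀ {a c ℓ} → a < n → Descent a c ℓ → R G (v a) (v c) (suc ℓ)
    descent⇒R a<n d =
      vertices d , (vertices-linked d , vertices-unique a<n d) , head-vertices d , last-vertices d , length-vertices d

below⊎above : ∀ a j → j ≤ 2 * a → (∃[ c ] c + j ≡ a) ⊎ (∃[ t ] ∃[ e ] e + t ≡ a × j ≡ a + t)
below⊎above a j j≤2a with ≤-total j a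
... | inj₁ j≤a = let c , j+c≡a = m≤n⇒∃[o]m+o≡n j≤a in inj₁ (c , trans (+-comm c j) j+c≡a)
... | inj₂ a≤j = let t , a+t≡j = m≤n⇒∃[o]m+o≡n a≤j
                     e , t+e≡a = m≤n⇒∃[o]m+o≡n (t≤a t a+t≡j)
                 in inj₂ (t , e , trans (+-comm e t) t+e≡a , ≡.sym a+t≡j)
  where
  t≤a : ∀ t → a + t ≡ j → t ≤ a
  t≤a t a+t≡j = +-cancelˡ-≤ a t a (subst (_≤ a + a) (≡.sym a+t≡j)
                  (subst (j ≤_) (cong (a +_) (+-identityʳ a)) j≤2a))

3*⊓≤ : ∀ a b → 3 * (a ⊓ b) ≤ a + 2 * b
3*⊓≤ a b = +-mono-≤ (m⊓n≤m a b) (+-mono-≤ (m⊓n≤n a b) (+-mono-≤ (m⊓n≤n a b) z≤n))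

-- With k = c+j+1: dU, dV are d(v_{2k}), d(v_{2k+1}); cU, cV count their neighbours among
-- v_1, …, v_{2k-1}; wU, wV count them on the two windows of length 2c+j+1.
degree-budget : ∀ c j {dU dV cU cV wU wV} →
  2 * (2 * suc (c + j) + 1) ≤ 3 * (dU ⊓ dV) →
  dU ≤ suc cU → dV ≤ suc cV →
  cU ≤ j + wU → cV ≤ wV + j → cV ≤ 2 * c + j →
  wV + wU ≤ 2 * c + suc j → ⊥
degree-budget c j {dU} {dV} {cU} {cV} {wU} {wV} H dU≤ dV≤ cU≤ cV≤ cV≤′ disjoint = <-irrefl refl (begin-strict
  4 * s                                          <⟨ m<m+n (4 * s) z<s ⟩
  4 * s + 2                                      ≡⟨ solve 2 (λ c j → con 4 :* s′ c j :+ con 2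
                                                      := con 2 :* (con 2 :* s′ c j :+ con 1)) refl c j ⟩
  2 * (2 * s + 1)                                ≤⟨ H ⟩
  3 * (dU ⊓ dV)                                  ≤⟨ 3*⊓≤ dU dV ⟩
  dU + 2 * dV                                    ≤⟨ +-mono-≤ (≤-trans dU≤ (s≤s cU≤))
                                                      (+-mono-≤ (≤-trans dV≤ (s≤s cV≤))
                                                        (+-mono-≤ (≤-trans dV≤ (s≤s cV≤′)) z≤n)) ⟩
  suc (j + wU) + (suc (wV + j) + (suc (2 * c + j) + 0))
    ≡⟨ solve 4 (λ c j wU wV → con 1 :+ (j :+ wU) :+ (con 1 :+ (wV :+ j) :+ (con 1 :+ (con 2 :* c :+ j) :+ con 0))
                           := wV :+ wU :+ (con 2 :* c :+ con 3 :* j :+ con 3)) refl c j wU wV ⟩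
  wV + wU + (2 * c + 3 * j + 3)                 ≤⟨ +-monoˡ-≤ _ disjoint ⟩
  2 * c + suc j + (2 * c + 3 * j + 3)
    ≡⟨ solve 2 (λ c j → con 2 :* c :+ (con 1 :+ j) :+ (con 2 :* c :+ con 3 :* j :+ con 3)
                     := con 4 :* s′ c j) refl c j ⟩
  4 * s                                          ∎)
  where
  open ≤-Reasoning
  s : ℕ
  s = suc (c + j)
  s′ : ∀ {m} → Polynomial m → Polynomial m → Polynomial m
  s′ c j = con 1 :+ (c :+ j)

module Saw (k-1 : ℕ) (S : Graph (suc (2 * suc k-1))) (saw : IsSaw (suc k-1) S) where

  -- With k = suc k-1, 2 * k reduces to suc (2 * k ∸ 1), so v (2 * k) below is vtx k (2 * k ∸ 1)
  -- by definition and sawDeg k S needs no rewriting.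
  k : ℕ
  k = suc k-1

  -- v i is the paper's v_i with indices modulo 2k+1; in particular v 0 = v_{2k+1}.
  v : ℕ → Fin (suc (2 * k))
  v zero    = vtx k (2 * k)
  v (suc i) = vtx k i

  open Descents S v

  odd : ℕ → ℕ
  odd t = suc (2 * t)

  2k≡ : 2 * k ≡ suc (odd k-1)
  2k≡ = *-suc 2 k-1

  v-injective : ∀ {a b} → a < suc (2 * k) → b < suc (2 * k) → v a ≡ v b → a ≡ b
  v-injective {zero}  {zero}  _   _   _  = refl
  v-injective {zero}  {suc b} _   b<n eq = ⊥-elim (<-irrefl b≡2k (s≤s⁻¹ b<n))
    where
    b≡2k : b ≡ 2 * k
    b≡2k = trans (≡.sym (toℕ-vtx k (<-trans (n<1+n b) b<n)))
                 (trans (≡.sym (cong toℕ eq)) (toℕ-vtx k ≤-refl))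
  v-injective {suc a} {zero}  a<n b<n eq = ≡.sym (v-injective b<n a<n (≡.sym eq))
  v-injective {suc a} {suc b} a<n b<n eq =
    cong suc (trans (≡.sym (toℕ-vtx k (<-trans (n<1+n a) a<n)))
                    (trans (cong toℕ eq) (toℕ-vtx k (<-trans (n<1+n b) b<n))))

  vtx-wraps : vtx k (suc (2 * k)) ≡ vtx k 0
  vtx-wraps = toℕ-injective (trans (toℕ-fromℕ< _) (n%n≡0 (suc (2 * k))))

  backbone-edge : ∀ i → i < 2 * k → Edge (suc i) i
  backbone-edge zero    _      = trans (Graph.sym S _ _)
    (subst (λ u → adj S (vtx k (2 * k)) u ≡ true) vtx-wraps (IsSaw.backbone saw (2 * k) ≤-refl))
  backbone-edge (suc i) 1+i<2k = trans (Graph.sym S _ _)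
    (IsSaw.backbone saw i (m<n⇒m<1+n (<-trans (n<1+n i) 1+i<2k)))

  wrap-edge : Edge (2 * k) 0
  wrap-edge = IsSaw.backbone saw (2 * k ∸ 1) (m<n⇒m<1+n (n<1+n (2 * k ∸ 1)))

  chord-edge : ∀ t → t < k → Edge (odd (suc t)) (odd t)
  chord-edge t t<k = trans (Graph.sym S _ _)
    (subst (λ x → adj S (vtx k (2 * t)) (vtx k x) ≡ true) 2t+2≡ (IsSaw.chords saw t t<k))
    where
    2t+2≡ : 2 * t + 2 ≡ 2 * suc t
    2t+2≡ = trans (+-comm (2 * t) 2) (≡.sym (*-suc 2 t))

  backbone-descent : ∀ d y → d + y ≤ 2 * k → Descent (d + y) y d
  backbone-descent zero    y _  = done
  backbone-descent (suc d) y lt = step (n<1+n (d + y)) (backbone-edge (d + y) lt) (backbone-descent d y (<⇒≤ lt))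

  chord-descent : ∀ e t → e + t ≤ k → Descent (odd (e + t)) (odd t) e
  chord-descent zero    t _  = done
  chord-descent (suc e) t lt =
    step (s<s (*-monoʳ-< 2 (n<1+n (e + t)))) (chord-edge (e + t) lt) (chord-descent e t (<⇒≤ lt))

  via-chords : ∀ t e d y → e + t ≡ k-1 → d + y ≡ odd t → 0 < y → Edge y 0 →
    Descent (2 * k) 0 (1 + (e + (d + 1)))
  via-chords t e d y e+t≡ d+y≡ 0<y y~0 = first ++ chords ++ backbone ++ step 0<y y~0 done
    where
    first : Descent (2 * k) (odd k-1) 1
    first = subst (λ a → Descent a (odd k-1) 1) (≡.sym 2k≡)
      (backbone-descent 1 (odd k-1) (≤-reflexive (≡.sym 2k≡)))
    chords : Descent (odd k-1) (odd t) e
    chords = subst (λ s → Descent (odd s) (odd t) e) e+t≡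
      (chord-descent e t (subst (_≤ k) (≡.sym e+t≡) (n≤1+n k-1)))
    odd-t≤2k : odd t ≤ 2 * k
    odd-t≤2k = ≤-trans (s≤s (*-monoʳ-≤ 2 (subst (t ≤_) e+t≡ (m≤n+m t e))))
                       (≤-trans (n≤1+n (odd k-1)) (≤-reflexive (≡.sym 2k≡)))
    backbone : Descent (odd t) y d
    backbone = subst (λ a → Descent a y d) d+y≡ (backbone-descent d y (subst (_≤ 2 * k) (≡.sym d+y≡) odd-t≤2k))

  via-shortcut : ∀ j y → 0 < y → j + y < 2 * k → Edge (2 * k) (j + y) → Edge y 0 →
    Descent (2 * k) 0 (1 + (j + 1))
  via-shortcut j y 0<y lt top~ y~0 = step lt top~ (backbone-descent j y (<⇒≤ lt) ++ step 0<y y~0 done)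

  long-descent : ∀ t e → e + t ≡ k-1 → Descent (2 * k) 0 (2 + (k-1 + t))
  long-descent t e e+t≡ = subst (Descent (2 * k) 0) length≡
    (via-chords t e (2 * t) 1 e+t≡ (+-comm (2 * t) 1) z<s (backbone-edge 0 z<s))
    where
    length≡ : 1 + (e + (2 * t + 1)) ≡ 2 + (k-1 + t)
    length≡ = trans (solve 2 (λ e t → con 1 :+ (e :+ (con 2 :* t :+ con 1)) := con 2 :+ ((e :+ t) :+ t)) refl e t)
                    (cong (λ x → 2 + (x + t)) e+t≡)

  adjV adjU : ℕ → Bool
  adjV x = adj S (v 0) (v (suc x))
  adjU x = adj S (v (2 * k)) (v (suc x))

  adjV⇒edge : ∀ x → adjV x ≡ true → Edge (suc x) 0
  adjV⇒edge _ hit = trans (Graph.sym S _ _) hit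

  deg-v : ∀ a → deg S (v a) ≡ count (λ i → adj S (v a) (v i)) (suc (2 * k))
  deg-v a = trans (deg≡count {k} S (v a))
    (trans (count-suc (λ i → q (vtx k i)) (2 * k)) (+-comm _ (indicator (q (v 0)))))
    where
    q : Fin (suc (2 * k)) → Bool
    q = adj S (v a)

  degV≤ : deg S (v 0) ≤ suc (count adjV (2 * k ∸ 1))
  degV≤ = ≤-trans (≤-reflexive (deg-v 0))
    (count-ends≤ (λ i → adj S (v 0) (v i)) (2 * k ∸ 1) (inj₁ (Graph.irrefl S _)))

  degU≤ : deg S (v (2 * k)) ≤ suc (count adjU (2 * k ∸ 1))
  degU≤ = ≤-trans (≤-reflexive (deg-v (2 * k)))
    (count-ends≤ (λ i → adj S (v (2 * k)) (v i)) (2 * k ∸ 1) (inj₂ (Graph.irrefl S _)))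

  short-via-chords : ∀ c j d → c + j ≡ k-1 → d ≤ j → adjV (2 * c + d) ≡ true → Descent (2 * k) 0 (2 + j)
  short-via-chords c j d c+j≡ d≤j V~2c+d = subst (Descent (2 * k) 0) length≡
    (via-chords (c + d) (j ∸ d) d (suc (2 * c + d)) e+t≡ d+y≡ z<s (adjV⇒edge (2 * c + d) V~2c+d))
    where
    j∸d+d≡j : j ∸ d + d ≡ j
    j∸d+d≡j = m∸n+n≡m d≤j
    e+t≡ : j ∸ d + (c + d) ≡ k-1
    e+t≡ = trans (solve 3 (λ x c d → x :+ (c :+ d) := c :+ (x :+ d)) refl (j ∸ d) c d)
                 (trans (cong (c +_) j∸d+d≡j) c+j≡)
    d+y≡ : d + suc (2 * c + d) ≡ odd (c + d)
    d+y≡ = solve 2 (λ c d → d :+ (con 1 :+ (con 2 :* c :+ d)) := con 1 :+ con 2 :* (c :+ d)) refl c d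
    length≡ : 1 + (j ∸ d + (d + 1)) ≡ 2 + j
    length≡ = trans (solve 2 (λ x d → con 1 :+ (x :+ (d :+ con 1)) := con 2 :+ (x :+ d)) refl (j ∸ d) d)
                    (cong (2 +_) j∸d+d≡j)

  short-via-shortcut : ∀ c j x → c + j ≡ k-1 → x < 2 * c + suc j →
    adjV x ≡ true → adjU (j + x) ≡ true → Descent (2 * k) 0 (2 + j)
  short-via-shortcut c j x c+j≡ x<M V~x U~j+x = subst (Descent (2 * k) 0) (cong suc (+-comm j 1))
    (via-shortcut j (suc x) z<s j+1+x<2k
      (subst (Edge (2 * k)) (≡.sym (+-suc j x)) U~j+x) (adjV⇒edge x V~x))
    where
    open ≤-Reasoning
    j+1+x<2k : j + suc x < 2 * k
    j+1+x<2k = begin-strict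
      j + suc x            ≤⟨ +-monoʳ-≤ j x<M ⟩
      j + (2 * c + suc j)  ≡⟨ solve 2 (λ c j → j :+ (con 2 :* c :+ (con 1 :+ j)) := con 1 :+ con 2 :* (c :+ j)) refl c j ⟩
      odd (c + j)          ≡⟨ cong odd c+j≡ ⟩
      odd k-1              <⟨ n<1+n (odd k-1) ⟩
      suc (odd k-1)        ≡⟨ ≡.sym 2k≡ ⟩
      2 * k                ∎

  short-obstruction : 2 * (2 * k + 1) ≤ 3 * sawDeg k S → ∀ c j → c + j ≡ k-1 →
    count (λ i → adjV (2 * c + i)) (suc j) ≡ 0 →
    count adjV (2 * c + suc j) + count (λ i → adjU (j + i)) (2 * c + suc j) ≤ 2 * c + suc j → ⊥
  short-obstruction H c j c+j≡ window-empty disjoint = degree-budget c j H′ degU≤ degV≤ cU≤ cV≤ cV≤′ disjoint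
    where
    H′ : 2 * (2 * suc (c + j) + 1) ≤ 3 * sawDeg k S
    H′ = subst (λ x → 2 * (2 * suc x + 1) ≤ 3 * sawDeg k S) (≡.sym c+j≡) H
    interior-window : ∀ p a m b → a + (m + b) ≡ odd (c + j) →
      count p (2 * k ∸ 1) ≤ a + (count (λ i → p (a + i)) m + b)
    interior-window p a m b split = subst (λ L → count p L ≤ a + (count (λ i → p (a + i)) m + b))
      (trans split (trans (cong odd c+j≡) (≡.sym (suc-injective 2k≡)))) (count-window p a m b)
    cV≤′ : count adjV (2 * k ∸ 1) ≤ 2 * c + j
    cV≤′ = subst (λ w → count adjV (2 * k ∸ 1) ≤ 2 * c + (w + j)) window-empty
      (interior-window adjV (2 * c) (suc j) j
        (solve 2 (λ c j → con 2 :* c :+ ((con 1 :+ j) :+ j) := con 1 :+ con 2 :* (c :+ j)) refl c j))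
    cV≤ : count adjV (2 * k ∸ 1) ≤ count adjV (2 * c + suc j) + j
    cV≤ = interior-window adjV 0 (2 * c + suc j) j
      (solve 2 (λ c j → con 2 :* c :+ (con 1 :+ j) :+ j := con 1 :+ con 2 :* (c :+ j)) refl c j)
    cU≤ : count adjU (2 * k ∸ 1) ≤ j + count (λ i → adjU (j + i)) (2 * c + suc j)
    cU≤ = ≤-trans (interior-window adjU j (2 * c + suc j) 0
            (solve 2 (λ c j → j :+ (con 2 :* c :+ (con 1 :+ j) :+ con 0) := con 1 :+ con 2 :* (c :+ j))
         refl c j))
          (≤-reflexive (cong (j +_) (+-identityʳ _)))

  short-descent : 2 * (2 * k + 1) ≤ 3 * sawDeg k S → ∀ c j → c + j ≡ k-1 → Descent (2 * k) 0 (2 + j)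
  short-descent H c j c+j≡ with count≡0⊎witness (λ i → adjV (2 * c + i)) (suc j)
  ... | inj₂ (d , d<1+j , V~2c+d) = short-via-chords c j d c+j≡ (s≤s⁻¹ d<1+j) V~2c+d
  ... | inj₁ window-empty with count-disjoint⊎common adjV (λ i → adjU (j + i)) (2 * c + suc j)
  ...   | inj₂ (x , x<M , V~x , U~j+x) = short-via-shortcut c j x c+j≡ x<M V~x U~j+x
  ...   | inj₁ disjoint                 = ⊥-elim (short-obstruction H c j c+j≡ window-empty disjoint)

  descent-of-length : 2 * (2 * k + 1) ≤ 3 * sawDeg k S → ∀ ℓ → 0 < ℓ → ℓ ≤ 2 * k → Descent (2 * k) 0 ℓ
  descent-of-length H (suc zero)    _ _  = step z<s wrap-edge done
  descent-of-length H (suc (suc j)) _ ℓ≤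
    with below⊎above k-1 j (s≤s⁻¹ (s≤s⁻¹ (subst (suc (suc j) ≤_) 2k≡ ℓ≤)))
  ... | inj₁ (c , c+j≡)            = short-descent H c j c+j≡
  ... | inj₂ (t , e , e+t≡ , refl) = long-descent t e e+t≡

  path-of-order : 2 * (2 * k + 1) ≤ 3 * sawDeg k S → ∀ ℓ → 0 < ℓ → ℓ ≤ 2 * k → R S (v (2 * k)) (v 0) (suc ℓ)
  path-of-order H ℓ 0<ℓ ℓ≤2k = descent⇒R v-injective (n<1+n (2 * k)) (descent-of-length H ℓ 0<ℓ ℓ≤2k)

lemma8 : (k : ℕ) (S : Graph (suc (2 * k))) → IsSaw k S →
    2 * (2 * k + 1) ≤ 3 * sawDeg k S →
    ∀ m → 2 ≤ m × m ≤ 2 * k + 1 →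
      R S (vtx k (2 * k ∸ 1)) (vtx k (2 * k)) m
lemma8 zero S saw _ _ _ with IsSaw.k≥1 saw
... | ()
lemma8 (suc k-1) S saw H (suc ℓ) (s≤s 0<ℓ , m≤) =
  Saw.path-of-order k-1 S saw H ℓ 0<ℓ (s≤s⁻¹ (subst (suc ℓ ≤_) (+-comm (2 * suc k-1) 1) m≤))
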